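{- For any integers $\ell \geq 4$, $k \geq 3$ and $n \geq \frac{\ell}{k}$, $sat(K_k^n,C_{\ell}) \geq kn$.
   Context: All graphs are finite, simple and undirected. $K_k^n$ denotes the complete $k$-partite graph with exactly $n$ vertices in each of its $k$ parts. $C_\ell$ denotes the cycle on $\ell$ vertices. For graphs $G$ and $F$, a spanning subgraph $H$ of $G$ is $F$-saturated relative to $G$ if $H$ contains no copy of $F$ but $H+e$ contains a copy of $F$ for every $e\in E(G)\setminus E(H)$; $sat(G,F)$ is the minimum number of edges of a graph that is $F$-saturated relative to $G$. -}

module Defs where

open import Data.Nat using (ℕ; suc; _*_; _+_; _∸_; _<ᵇ_)
open import Data.Fin using (Fin; toℕ)
open import Data.Fin.Properties using (_≟_)
open import Data.Bool using (Bool; true; false; _∧_; _∨_)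
open import Data.Product using (_×_; _,_; proj₁; proj₂; Σ)
open import Data.Sum using (_⊎_)
open import Data.List using (List; length; filter; allFin; cartesianProduct)
open import Function.Definitions using (Injective)
open import Relation.Binary.PropositionalEquality using (_≡_; _≢_)
open import Relation.Nullary using (¬_)
open import Relation.Nullary.Decidable using (⌊_⌋; does)
open import Data.Bool.Properties using (T?)
open import Data.Bool using (T)

-- Vertex set of K_k^n: (part, index within part).
Vtx : ℕ → ℕ → Set
Vtx k n = Fin k × Fin n

record Graph (V : Set) : Set where
  field
    adj   : V → V → Bool
    sym   : ∀ u v → adj u v ≡ adj v u
    irrefl : ∀ v → adj v v ≡ false
open Graph public

hostAdj : ∀ {k n} → Vtx k n → Vtx k n → Set
hostAdj u v = proj₁ u ≢ proj₁ v

SubgraphOfHost : ∀ {k n} → Graph (Vtx k n) → Set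
SubgraphOfHost {k} {n} H = ∀ (u v : Vtx k n) → T (adj H u v) → hostAdj u v

AdjPlus : ∀ {V : Set} → (V → V → Bool) → V → V → V → V → Set
AdjPlus A u v x y = T (A x y) ⊎ ((x ≡ u × y ≡ v) ⊎ (x ≡ v × y ≡ u))

-- A (not necessarily induced) copy of the cycle C_ℓ in a graph with adjacency Adj:
-- an injective map f : Fin ℓ → V with f i ~ f (i+1 mod ℓ) for all i.
ContainsCycle : ∀ {V : Set} → ℕ → (V → V → Set) → Set
ContainsCycle {V} ℓ Adj =
  Σ (Fin ℓ → V) λ f → Injective _≡_ _≡_ f ×
    (∀ (i j : Fin ℓ) →
       (toℕ j ≡ suc (toℕ i) ⊎ (toℕ i ≡ ℓ ∸ 1 × toℕ j ≡ 0)) →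
       Adj (f i) (f j))

SaturatedRel : ∀ k n → ℕ → Graph (Vtx k n) → Set
SaturatedRel k n ℓ H =
  SubgraphOfHost H ×
  (¬ ContainsCycle ℓ (λ x y → T (adj H x y))) ×
  (∀ (u v : Vtx k n) → hostAdj u v → ¬ T (adj H u v) →
     ContainsCycle ℓ (AdjPlus (adj H) u v))

-- Linear index of a vertex, used to count each unordered edge once.
index : ∀ {k n} → Vtx k n → ℕ
index {k} {n} (i , j) = toℕ i * n + toℕ j

allVtx : ∀ k n → List (Vtx k n)
allVtx k n = cartesianProduct (allFin k) (allFin n)

edgeCount : ∀ {k n} → Graph (Vtx k n) → ℕ
edgeCount {k} {n} H =
  length (filter (λ p → T? (adj H (proj₁ p) (proj₂ p) ∧ (index (proj₁ p) <ᵇ index (proj₂ p))))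
                 (cartesianProduct (allVtx k n) (allVtx k n)))

-- Call x anchored if some vertex list K ∋ x gives x a neighbour in K and every other vertex of K two
-- distinct neighbours in K, as a cycle together with a path from it to x does. If every vertex is
-- anchored, deleting a vertex of degree at most one (it has degree exactly one) keeps all others
-- anchored, so by induction the degree sum is at least twice the number of vertices: H has at least
-- kn edges. In a saturated H every vertex x is anchored. Adding a missing edge uv of K_k^n creates a
-- C_ℓ through uv, i.e. a u–v path in H with ℓ vertices. A non-backtracking walk from x closes a cycle
-- or gets stuck at a leaf a with neighbour b. Take y in a third part: the path a b … y either closes
-- with the edge yb into a cycle, or together with a path y … b forms a closed walk of odd length
-- 2ℓ − 3, which contains a cycle.
module Submission where

import Algebra.Properties.CommutativeSemigroup
open import Data.Bool using (Bool; true; false; T; _∧_)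
open import Data.Bool.Properties using (T?)
open import Data.Fin as Fin using (Fin; zero; suc; toℕ; inject₁; fromℕ)
import Data.Fin.Properties as Finₚ
open import Data.List using (List; []; _∷_; _++_; _∷ʳ_; [_]; initLast; _∷ʳ′_; length; reverse; filter; map; tabulate; allFin; cartesianProduct)
open import Data.List.Properties using (++-assoc; ++-identityʳ; length-++; length-map; length-reverse; length-tabulate; reverse-++; unfold-reverse; filter-notAll)
open import Data.List.Membership.Propositional using (_∈_; _∉_; find)
open import Data.List.Membership.Propositional.Properties using (∈-++⁺ˡ; ∈-++⁺ʳ; ∈-∃++; ∈-filter⁺; ∈-filter⁻; ∈-allFin; ∈-cartesianProduct⁺)
import Data.List.Relation.Binary.Permutation.Setoid as Permutation
import Data.List.Relation.Binary.Permutation.Setoid.Properties as Permutationₚ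
open import Data.List.Relation.Binary.Subset.Propositional using (_⊆_)
open import Data.List.Relation.Unary.All as All using (All; []; _∷_)
open import Data.List.Relation.Unary.All.Properties using (¬Any⇒All¬; All¬⇒¬Any; ∷ʳ⁺; ++⁻ˡ)
open import Data.List.Relation.Unary.Any as Any using (Any; here; there; any?)
open import Data.List.Relation.Unary.Unique.Propositional using (Unique; []; _∷_)
open import Data.List.Relation.Unary.Unique.Propositional.Properties using (tabulate⁺; allFin⁺; cartesianProduct⁺)
open import Data.Nat using (ℕ; zero; suc; _+_; _*_; _∸_; _%_; _<ᵇ_; _≤_; _<_; z≤n; s≤s; _≤?_)
open import Data.Nat.DivMod using (%-distribˡ-+; [m+kn]%n≡m%n; m%n<n)
open import Data.Nat.Properties
open import Data.Nat.Tactic.RingSolver using (solve-∀)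
open import Data.Product using (Σ-syntax; _×_; _,_; proj₁; proj₂)
open import Data.Product.Properties using (≡-dec)
open import Data.Sum using (_⊎_; inj₁; inj₂; [_,_]′)
open import Data.Unit using (⊤; tt)
open import Defs hiding (sym)
open import Function using (_∘_; id)
open import Relation.Binary.Construct.Closure.ReflexiveTransitive using (Star; ε; _◅_; _◅◅_)
open import Relation.Binary.Definitions using (DecidableEquality)
open import Relation.Binary.PropositionalEquality using (_≡_; _≢_; ≢-sym; refl; sym; trans; cong; cong₂; subst; module ≡-Reasoning)
open import Relation.Binary.PropositionalEquality.Properties using (setoid)
open import Relation.Nullary using (¬_; Dec; yes; no; contradiction)
open import Relation.Nullary.Decidable using (¬?; _×-dec_)

open Algebra.Properties.CommutativeSemigroup +-commutativeSemigroup using (interchange; x∙yz≈y∙xz)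

module _ {X : Set} where

  ∑ : List X → (X → ℕ) → ℕ
  ∑ [] f = 0
  ∑ (x ∷ xs) f = f x + ∑ xs f

  syntax ∑ xs (λ x → e) = ∑[ x ∈ xs ] e

  ∑-cong : ∀ xs {f g : X → ℕ} → (∀ x → f x ≡ g x) → ∑ xs f ≡ ∑ xs g
  ∑-cong [] f≗g = refl
  ∑-cong (x ∷ xs) f≗g = cong₂ _+_ (f≗g x) (∑-cong xs f≗g)

  ∑-+ : ∀ xs (f g : X → ℕ) → ∑[ x ∈ xs ] (f x + g x) ≡ ∑ xs f + ∑ xs g
  ∑-+ [] f g = refl
  ∑-+ (x ∷ xs) f g = trans (cong (f x + g x +_) (∑-+ xs f g)) (interchange (f x) (g x) (∑ xs f) (∑ xs g))

  ∑-mono-≤ : ∀ xs {f g : X → ℕ} → (∀ {x} → x ∈ xs → f x ≤ g x) → ∑ xs f ≤ ∑ xs g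
  ∑-mono-≤ [] f≤g = z≤n
  ∑-mono-≤ (x ∷ xs) f≤g = +-mono-≤ (f≤g (here refl)) (∑-mono-≤ xs (f≤g ∘ there))

  ∑-const : ∀ xs c → ∑[ _ ∈ xs ] c ≡ length xs * c
  ∑-const [] c = refl
  ∑-const (x ∷ xs) c = cong (c +_) (∑-const xs c)

  ∑-++ : ∀ xs ys (f : X → ℕ) → ∑ (xs ++ ys) f ≡ ∑ xs f + ∑ ys f
  ∑-++ [] ys f = refl
  ∑-++ (x ∷ xs) ys f = trans (cong (f x +_) (∑-++ xs ys f)) (sym (+-assoc (f x) _ _))

  ∑-remove : ∀ xs y ys (f : X → ℕ) → ∑ (xs ++ y ∷ ys) f ≡ f y + ∑ (xs ++ ys) f
  ∑-remove xs y ys f = begin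
    ∑ (xs ++ y ∷ ys) f          ≡⟨ ∑-++ xs (y ∷ ys) f ⟩
    ∑ xs f + (f y + ∑ ys f)     ≡⟨ x∙yz≈y∙xz (∑ xs f) (f y) (∑ ys f) ⟩
    f y + (∑ xs f + ∑ ys f)     ≡⟨ cong (f y +_) (∑-++ xs ys f) ⟨
    f y + ∑ (xs ++ ys) f        ∎
    where open ≡-Reasoning

  ∑-≥-term : ∀ {xs x} (f : X → ℕ) → x ∈ xs → f x ≤ ∑ xs f
  ∑-≥-term {y ∷ xs} f (here refl) = m≤m+n (f y) (∑ xs f)
  ∑-≥-term {y ∷ xs} f (there x∈xs) = ≤-trans (∑-≥-term f x∈xs) (m≤n+m (∑ xs f) (f y))

  ∑-≥-two-terms : ∀ {xs a b} (f : X → ℕ) → a ∈ xs → b ∈ xs → a ≢ b → f a + f b ≤ ∑ xs f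
  ∑-≥-two-terms f (here refl) (here refl) a≢b = contradiction refl a≢b
  ∑-≥-two-terms {y ∷ xs} f (here refl) (there b∈xs) _ = +-monoʳ-≤ (f y) (∑-≥-term f b∈xs)
  ∑-≥-two-terms {y ∷ xs} {a} f (there a∈xs) (here refl) _ =
    subst (_≤ f y + ∑ xs f) (+-comm (f y) (f a)) (+-monoʳ-≤ (f y) (∑-≥-term f a∈xs))
  ∑-≥-two-terms {y ∷ xs} f (there a∈xs) (there b∈xs) a≢b =
    ≤-trans (∑-≥-two-terms f a∈xs b∈xs a≢b) (m≤n+m (∑ xs f) (f y))

module _ {X : Set} where

  open Permutation (setoid X) public using (_↭_; ↭-sym; ↭-trans; ↭-prep; ↭-reflexive)
  open Permutationₚ (setoid X) public using (Unique-resp-↭; ∈-resp-↭; ++-comm; shift; ∷↭∷ʳ; ↭-reverse; xs↭ys⇒|xs|≡|ys|; ++⁺ʳ)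

  length-∷ʳ : ∀ (xs : List X) y → length (xs ∷ʳ y) ≡ suc (length xs)
  length-∷ʳ xs y = trans (length-++ xs) (+-comm (length xs) 1)

  3≤length : ∀ (x y : X) zs w → 3 ≤ length (x ∷ y ∷ zs ∷ʳ w)
  3≤length _ _ zs w = s≤s (s≤s (subst (1 ≤_) (sym (length-∷ʳ zs w)) (s≤s z≤n)))

  Unique-++⁻ˡ : ∀ (xs : List X) {ys} → Unique (xs ++ ys) → Unique xs
  Unique-++⁻ˡ [] _ = []
  Unique-++⁻ˡ (x ∷ xs) (x≢ ∷ xs!) = ++⁻ˡ {P = x ≢_} xs x≢ ∷ Unique-++⁻ˡ xs xs!

  Unique-remove : ∀ xs {y} ys → Unique (xs ++ y ∷ ys) → y ∉ xs ++ ys × Unique (xs ++ ys)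
  Unique-remove xs ys u with Unique-resp-↭ (shift refl xs ys) u
  ... | y≢ ∷ u′ = All¬⇒¬Any y≢ , u′

  cut-loop-↭ : ∀ as y bs ds → as ++ y ∷ bs ++ y ∷ ds ↭ (y ∷ bs) ++ as ++ y ∷ ds
  cut-loop-↭ as y bs ds =
    ↭-trans (↭-reflexive (sym (++-assoc as (y ∷ bs) (y ∷ ds))))
      (↭-trans (++⁺ʳ (y ∷ ds) (++-comm as (y ∷ bs))) (↭-reflexive (++-assoc (y ∷ bs) as (y ∷ ds))))

  ∈-remove : ∀ xs {x y} ys → x ∈ xs ++ y ∷ ys → x ≢ y → x ∈ xs ++ ys
  ∈-remove xs ys x∈ x≢y with ∈-resp-↭ (shift refl xs ys) x∈
  ... | here x≡y = contradiction x≡y x≢y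
  ... | there x∈′ = x∈′

module WithDecidableEquality {X : Set} (_≟_ : DecidableEquality X) where

  open import Data.List.Membership.DecPropositional _≟_ public using (_∈?_)

  infixl 5 _∖_
  _∖_ : List X → X → List X
  xs ∖ x = filter (λ y → ¬? (y ≟ x)) xs

  ∈-∖⁺ : ∀ {xs x y} → y ∈ xs → y ≢ x → y ∈ xs ∖ x
  ∈-∖⁺ = ∈-filter⁺ (λ y → ¬? (y ≟ _))

  ∈-∖⁻ : ∀ {xs x y} → y ∈ xs ∖ x → y ∈ xs × y ≢ x
  ∈-∖⁻ = ∈-filter⁻ (λ y → ¬? (y ≟ _))

  Unique⊆⇒length≤ : ∀ {xs ys} → Unique xs → xs ⊆ ys → length xs ≤ length ys
  Unique⊆⇒length≤ {[]} _ _ = z≤n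
  Unique⊆⇒length≤ {x ∷ xs} {ys} (x≢xs ∷ xs!) xs⊆ys =
    ≤-trans (s≤s (Unique⊆⇒length≤ xs! xs⊆ys∖x)) (filter-notAll (λ y → ¬? (y ≟ x)) ys x∈ys)
    where
    xs⊆ys∖x : xs ⊆ ys ∖ x
    xs⊆ys∖x y∈xs = ∈-∖⁺ (xs⊆ys (there y∈xs)) (≢-sym (All.lookup x≢xs y∈xs))
    x∈ys : Any (λ y → ¬ ¬ (y ≡ x)) ys
    x∈ys = Any.map (λ { refl y≢x → y≢x refl }) (xs⊆ys (here refl))

  unique-or-repeat : ∀ xs → Unique xs ⊎ Σ[ as ∈ List X ] Σ[ y ∈ X ] Σ[ bs ∈ List X ] Σ[ ds ∈ List X ]
                                            xs ≡ as ++ y ∷ bs ++ y ∷ ds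
  unique-or-repeat [] = inj₁ []
  unique-or-repeat (x ∷ xs) with x ∈? xs
  ... | yes x∈xs with bs , ds , refl ← ∈-∃++ x∈xs = inj₂ ([] , x , bs , ds , refl)
  ... | no x∉xs with unique-or-repeat xs
  ...   | inj₁ xs! = inj₁ (¬Any⇒All¬ xs x∉xs ∷ xs!)
  ...   | inj₂ (as , y , bs , ds , refl) = inj₂ (x ∷ as , y , bs , ds , refl)

∑-map : ∀ {X Y : Set} (g : X → Y) xs (f : Y → ℕ) → ∑ (map g xs) f ≡ ∑ xs (f ∘ g)
∑-map g [] f = refl
∑-map g (x ∷ xs) f = cong (f (g x) +_) (∑-map g xs f)

module _ {X Y : Set} where

  ∑-cartesianProduct : ∀ (xs : List X) (ys : List Y) (h : X × Y → ℕ) → ∑ (cartesianProduct xs ys) h ≡ ∑[ x ∈ xs ] ∑[ y ∈ ys ] h (x , y)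
  ∑-cartesianProduct [] ys h = refl
  ∑-cartesianProduct (x ∷ xs) ys h =
    trans (∑-++ (map (x ,_) ys) _ h) (cong₂ _+_ (∑-map (x ,_) ys h) (∑-cartesianProduct xs ys h))

  ∑-comm : ∀ xs ys (F : X → Y → ℕ) → ∑[ x ∈ xs ] ∑[ y ∈ ys ] F x y ≡ ∑[ y ∈ ys ] ∑[ x ∈ xs ] F x y
  ∑-comm [] ys F = sym (trans (∑-const ys 0) (*-zeroʳ (length ys)))
  ∑-comm (x ∷ xs) ys F = trans (cong (∑ ys (F x) +_) (∑-comm xs ys F)) (sym (∑-+ ys (F x) _))

  length-cartesianProduct : ∀ (xs : List X) (ys : List Y) → length (cartesianProduct xs ys) ≡ length xs * length ys
  length-cartesianProduct [] ys = refl
  length-cartesianProduct (x ∷ xs) ys =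
    trans (length-++ (map (x ,_) ys)) (cong₂ _+_ (length-map (x ,_) ys) (length-cartesianProduct xs ys))

Odd : ℕ → Set
Odd n = n % 2 ≡ 1

parity : ∀ n → n % 2 ≡ 0 ⊎ Odd n
parity n with n % 2 | m%n<n n 2
... | 0 | _ = inj₁ refl
... | 1 | _ = inj₂ refl
... | suc (suc _) | s≤s (s≤s ())

odd-+ : ∀ a b → Odd (a + b) → Odd a ⊎ Odd b
odd-+ a b odd with parity a | parity b
... | inj₂ odd-a | _ = inj₁ odd-a
... | _ | inj₂ odd-b = inj₂ odd-b
... | inj₁ even-a | inj₁ even-b =
  contradiction (trans (sym odd) (trans (%-distribˡ-+ a b 2) (cong₂ (λ p q → (p + q) % 2) even-a even-b))) λ ()

odd-1+2* : ∀ m → Odd (suc (m * 2))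
odd-1+2* m = [m+kn]%n≡m%n 1 m 2

module _ {V : Set} (R : V → V → Set) where

  Chain : V → List V → Set
  Chain x [] = ⊤
  Chain x (y ∷ ys) = R x y × Chain y ys

  end : V → List V → V
  end x [] = x
  end x (y ∷ ys) = end y ys

  end-∷ʳ : ∀ x xs y → end x (xs ∷ʳ y) ≡ y
  end-∷ʳ x [] y = refl
  end-∷ʳ x (z ∷ zs) y = end-∷ʳ z zs y

  Chain-++⁻ : ∀ x xs {ys} → Chain x (xs ++ ys) → Chain x xs × Chain (end x xs) ys
  Chain-++⁻ x [] c = tt , c
  Chain-++⁻ x (y ∷ xs) (r , c) = let (c₁ , c₂) = Chain-++⁻ y xs c in (r , c₁) , c₂

  Chain-++⁺ : ∀ {x} xs {ys} → Chain x xs → Chain (end x xs) ys → Chain x (xs ++ ys)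
  Chain-++⁺ [] _ c = c
  Chain-++⁺ (y ∷ xs) (r , c₁) c₂ = r , Chain-++⁺ xs c₁ c₂

  Chain-∷ʳ⁻ : ∀ x xs {y} → Chain x (xs ∷ʳ y) → Chain x xs × R (end x xs) y
  Chain-∷ʳ⁻ x xs c = let (c₁ , r , _) = Chain-++⁻ x xs c in c₁ , r

  Chain-∷ʳ⁺ : ∀ {x} xs {y} → Chain x xs → R (end x xs) y → Chain x (xs ∷ʳ y)
  Chain-∷ʳ⁺ xs c r = Chain-++⁺ xs c (r , tt)

  Chain-reverse : (∀ {a b} → R a b → R b a) → ∀ {x} xs {y} → Chain x (xs ∷ʳ y) → Chain y (reverse xs ∷ʳ x)
  Chain-reverse R-sym [] (r , _) = R-sym r , tt
  Chain-reverse R-sym {x} (z ∷ zs) {y} (r , c) =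
    subst (λ ws → Chain y (ws ∷ʳ x)) (sym (unfold-reverse z zs))
      (Chain-∷ʳ⁺ (reverse zs ∷ʳ z) (Chain-reverse R-sym zs c)
        (subst (λ w → R w x) (sym (end-∷ʳ y (reverse zs) z)) (R-sym r)))

  Closed : List V → Set
  Closed [] = ⊤
  Closed (x ∷ xs) = Chain x (xs ∷ʳ x)

  Closed-rotate : ∀ xs ys → Closed (xs ++ ys) → Closed (ys ++ xs)
  Closed-rotate [] ys c = subst Closed (sym (++-identityʳ ys)) c
  Closed-rotate (x ∷ xs) [] c = subst Closed (++-identityʳ (x ∷ xs)) c
  Closed-rotate (x ∷ xs) (y ∷ ys) c
    with c₁ , r₁ , c₂ ← Chain-++⁻ x xs (subst (Chain x) (++-assoc xs (y ∷ ys) [ x ]) c)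
    with c₂′ , r₂ ← Chain-∷ʳ⁻ y ys c₂ =
    subst (Chain y) (sym (++-assoc ys (x ∷ xs) [ y ])) (Chain-++⁺ ys c₂′ (r₂ , Chain-∷ʳ⁺ xs c₁ r₁))

  Closed-split : ∀ y bs cs → Closed (y ∷ bs ++ y ∷ cs) → Closed (y ∷ bs) × Closed (y ∷ cs)
  Closed-split y bs cs c
    with c₁ , r , c₂ ← Chain-++⁻ y bs (subst (Chain y) (++-assoc bs (y ∷ cs) [ y ]) c) =
    Chain-∷ʳ⁺ bs c₁ r , c₂

CyclicSuccessor : ∀ {ℓ} → Fin ℓ → Fin ℓ → Set
CyclicSuccessor {ℓ} i j = toℕ j ≡ suc (toℕ i) ⊎ (toℕ i ≡ ℓ ∸ 1 × toℕ j ≡ 0)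

cyclicSuccessor-cases : ∀ {m} {i j : Fin (suc m)} → CyclicSuccessor i j →
                        (Σ[ k ∈ Fin m ] i ≡ inject₁ k × j ≡ suc k) ⊎ (i ≡ fromℕ m × j ≡ zero)
cyclicSuccessor-cases {j = suc k} (inj₁ e) =
  inj₁ (k , Finₚ.toℕ-injective (trans (sym (suc-injective e)) (sym (Finₚ.toℕ-inject₁ k))) , refl)
cyclicSuccessor-cases {m} (inj₂ (e₁ , e₂)) =
  inj₂ (Finₚ.toℕ-injective (trans e₁ (sym (Finₚ.toℕ-fromℕ m))) , Finₚ.toℕ-injective e₂)

module _ {V : Set} {R : V → V → Set} where

  Chain-tabulate⁺ : ∀ {m} (f : Fin (suc m) → V) {y} → (∀ k → R (f (inject₁ k)) (f (suc k))) →
                    R (f (fromℕ m)) y → Chain R (f zero) (tabulate (f ∘ suc) ∷ʳ y)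
  Chain-tabulate⁺ {zero} f _ r = r , tt
  Chain-tabulate⁺ {suc m} f step r = step zero , Chain-tabulate⁺ (f ∘ suc) (step ∘ suc) r

  Chain-tabulate⁻ : ∀ {m} (f : Fin (suc m) → V) {y} → Chain R (f zero) (tabulate (f ∘ suc) ∷ʳ y) →
                    (∀ k → R (f (inject₁ k)) (f (suc k))) × R (f (fromℕ m)) y
  Chain-tabulate⁻ {zero} f (r , _) = (λ ()) , r
  Chain-tabulate⁻ {suc m} f (r₀ , c) =
    let (step , r) = Chain-tabulate⁻ (f ∘ suc) c in (λ { zero → r₀ ; (suc k) → step k }) , r

  closed-tabulate⁺ : ∀ {m} (f : Fin (suc m) → V) → (∀ i j → CyclicSuccessor i j → R (f i) (f j)) →
                     Closed R (tabulate f)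
  closed-tabulate⁺ {m} f adj =
    Chain-tabulate⁺ f (λ k → adj _ _ (inj₁ (cong suc (sym (Finₚ.toℕ-inject₁ k)))))
                      (adj _ _ (inj₂ (Finₚ.toℕ-fromℕ m , refl)))

  closed-tabulate⁻ : ∀ {m} (f : Fin (suc m) → V) → Closed R (tabulate f) →
                     ∀ i j → CyclicSuccessor i j → R (f i) (f j)
  closed-tabulate⁻ f closed i j succ with step , r ← Chain-tabulate⁻ f closed with cyclicSuccessor-cases succ
  ... | inj₁ (k , refl , refl) = step k
  ... | inj₂ (refl , refl) = r

⟦_⟧ : Bool → ℕ
⟦ true ⟧ = 1
⟦ false ⟧ = 0

⟦T⟧ : ∀ {b} → T b → ⟦ b ⟧ ≡ 1
⟦T⟧ {true} _ = refl

length-filter-T? : ∀ {X : Set} (g : X → Bool) xs → length (filter (T? ∘ g) xs) ≡ ∑[ x ∈ xs ] ⟦ g x ⟧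
length-filter-T? g [] = refl
length-filter-T? g (x ∷ xs) with g x
... | true = cong suc (length-filter-T? g xs)
... | false = length-filter-T? g xs

module WithGraph {V : Set} (_≟_ : DecidableEquality V) (G : Graph V) where

  open WithDecidableEquality _≟_

  infix 4 _~_
  _~_ : V → V → Set
  u ~ v = T (adj G u v)

  ~-sym : ∀ {u v} → u ~ v → v ~ u
  ~-sym {u} {v} = subst T (Graph.sym G u v)

  ~-irrefl : ∀ {u} → ¬ u ~ u
  ~-irrefl {u} = subst T (irrefl G u)

  _~?_ : ∀ u v → Dec (u ~ v)
  u ~? v = T? (adj G u v)

  deg : List V → V → ℕ
  deg s v = ∑[ u ∈ s ] ⟦ adj G v u ⟧

  degSum : List V → ℕ
  degSum s = ∑[ v ∈ s ] deg s v

  deg-remove : ∀ as v bs w → deg (as ++ v ∷ bs) w ≡ ⟦ adj G w v ⟧ + deg (as ++ bs) w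
  deg-remove as v bs w = ∑-remove as v bs (λ u → ⟦ adj G w u ⟧)

  degSum-remove : ∀ as v bs → let s = as ++ v ∷ bs in degSum s ≡ deg s v + (deg s v + degSum (as ++ bs))
  degSum-remove as v bs = begin
    degSum s                                              ≡⟨ ∑-remove as v bs (deg s) ⟩
    deg s v + ∑[ w ∈ s′ ] deg s w                         ≡⟨ cong (deg s v +_) (∑-cong s′ (deg-remove as v bs)) ⟩
    deg s v + ∑[ w ∈ s′ ] (⟦ adj G w v ⟧ + deg s′ w)      ≡⟨ cong (deg s v +_) (∑-+ s′ _ (deg s′)) ⟩
    deg s v + (∑[ w ∈ s′ ] ⟦ adj G w v ⟧ + degSum s′)     ≡⟨ cong (λ d → deg s v + (d + degSum s′)) deg′≡deg ⟩
    deg s v + (deg s v + degSum s′)                       ∎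
    where
    open ≡-Reasoning
    s = as ++ v ∷ bs
    s′ = as ++ bs
    deg′≡deg : ∑[ w ∈ s′ ] ⟦ adj G w v ⟧ ≡ deg s v
    deg′≡deg = begin
      ∑[ w ∈ s′ ] ⟦ adj G w v ⟧    ≡⟨ ∑-cong s′ (λ w → cong ⟦_⟧ (Graph.sym G w v)) ⟩
      deg s′ v                     ≡⟨ cong (λ b → ⟦ b ⟧ + deg s′ v) (irrefl G v) ⟨
      ⟦ adj G v v ⟧ + deg s′ v     ≡⟨ deg-remove as v bs v ⟨
      deg s v                      ∎

  deg-≥-1 : ∀ {s x y} → y ∈ s → x ~ y → 1 ≤ deg s x
  deg-≥-1 {s} {x} y∈s x~y = subst (_≤ deg s x) (⟦T⟧ x~y) (∑-≥-term (λ u → ⟦ adj G x u ⟧) y∈s)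

  TwoNbrsIn : List V → V → Set
  TwoNbrsIn K u = Σ[ a ∈ V ] Σ[ b ∈ V ] a ∈ K × b ∈ K × a ≢ b × u ~ a × u ~ b

  deg-≥-2 : ∀ {K s u} → K ⊆ s → TwoNbrsIn K u → 2 ≤ deg s u
  deg-≥-2 {s = s} {u} K⊆s (a , b , a∈K , b∈K , a≢b , u~a , u~b) =
    subst (_≤ deg s u) (cong₂ _+_ (⟦T⟧ u~a) (⟦T⟧ u~b)) (∑-≥-two-terms (λ w → ⟦ adj G u w ⟧) (K⊆s a∈K) (K⊆s b∈K) a≢b)

  record Anchor (K : List V) (x : V) : Set where
    field
      root∈ : x ∈ K
      rootNbr : Σ[ y ∈ V ] y ∈ K × x ~ y
      twoNbrs : ∀ {u} → u ∈ K → u ≢ x → TwoNbrsIn K u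

  AnchoredIn : List V → V → Set
  AnchoredIn s x = Σ[ K ∈ List V ] K ⊆ s × Anchor K x

  AnchoredIn-remove : ∀ as {v} bs → deg (as ++ v ∷ bs) v < 2 → v ∉ as ++ bs →
                      ∀ {x} → x ∈ as ++ bs → AnchoredIn (as ++ v ∷ bs) x → AnchoredIn (as ++ bs) x
  AnchoredIn-remove as bs deg<2 v∉s′ x∈s′ (K , K⊆s , anchor) = K , K⊆s′ , anchor
    where
    open Anchor anchor
    v∉K : _ ∉ K
    v∉K v∈K = <⇒≱ deg<2 (deg-≥-2 K⊆s (twoNbrs v∈K λ { refl → v∉s′ x∈s′ }))
    K⊆s′ : K ⊆ as ++ bs
    K⊆s′ u∈K = ∈-remove as bs (K⊆s u∈K) λ { refl → v∉K u∈K }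

  length*2≤degSum : ∀ n s → length s ≡ n → Unique s → (∀ {x} → x ∈ s → AnchoredIn s x) → length s * 2 ≤ degSum s
  length*2≤degSum zero s |s|≡0 _ _ = subst (λ l → l * 2 ≤ degSum s) (sym |s|≡0) z≤n
  length*2≤degSum (suc n) s |s|≡1+n s! anchored with any? (λ v → suc (deg s v) ≤? 2) s
  ... | no ¬low = subst (_≤ degSum s) (∑-const s 2)
                    (∑-mono-≤ s λ v∈s → ≮⇒≥ (All.lookup (¬Any⇒All¬ s ¬low) v∈s))
  ... | yes low with v , v∈s , deg<2 ← find low with as , bs , refl ← ∈-∃++ v∈s
    with v∉s′ , s′! ← Unique-remove as bs s! = begin
    length s * 2                       ≡⟨ cong (_* 2) |s|≡1+|s′| ⟩
    suc (length s′) * 2                ≤⟨ s≤s (s≤s IH) ⟩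
    1 + (1 + degSum s′)                ≡⟨ cong (λ d → d + (d + degSum s′)) deg≡1 ⟨
    deg s v + (deg s v + degSum s′)    ≡⟨ degSum-remove as v bs ⟨
    degSum s                           ∎
    where
    open ≤-Reasoning
    s′ = as ++ bs
    |s|≡1+|s′| : length s ≡ suc (length s′)
    |s|≡1+|s′| = xs↭ys⇒|xs|≡|ys| (shift refl as bs)
    deg≡1 : deg s v ≡ 1
    deg≡1 with K , K⊆s , anchor ← anchored v∈s with y , y∈K , v~y ← Anchor.rootNbr anchor =
      ≤-antisym (≤-pred deg<2) (deg-≥-1 (K⊆s y∈K) v~y)
    IH : length s′ * 2 ≤ degSum s′
    IH = length*2≤degSum n s′ (suc-injective (trans (sym |s|≡1+|s′|) |s|≡1+n)) s′!
           λ x∈s′ → AnchoredIn-remove as bs deg<2 v∉s′ x∈s′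
                      (anchored (∈-resp-↭ (↭-sym (shift refl as bs)) (there x∈s′)))

  Chain⇒Star : ∀ {x xs c} → Chain _~_ x xs → c ∈ x ∷ xs → Star _~_ x c
  Chain⇒Star _ (here refl) = ε
  Chain⇒Star {xs = _ ∷ _} (x~y , c) (there c∈xs) = x~y ◅ Chain⇒Star c c∈xs

  Closed⇒Star : ∀ {x xs c} → Closed _~_ (x ∷ xs) → c ∈ x ∷ xs → Star _~_ x c
  Closed⇒Star closed c∈ = Chain⇒Star closed (here-or-prefix c∈)
    where
    here-or-prefix : ∀ {c x xs} → c ∈ x ∷ xs → c ∈ x ∷ xs ∷ʳ x
    here-or-prefix (here e) = here e
    here-or-prefix (there c∈xs) = there (∈-++⁺ˡ c∈xs)

  TwoNbrsIn-⊆ : ∀ {K K′ u} → K ⊆ K′ → TwoNbrsIn K u → TwoNbrsIn K′ u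
  TwoNbrsIn-⊆ K⊆K′ (a , b , a∈K , b∈K , rest) = a , b , K⊆K′ a∈K , K⊆K′ b∈K , rest

  Core : List V → Set
  Core K = ∀ {u} → u ∈ K → TwoNbrsIn K u

  Core⇒Anchor : ∀ {K c} → Core K → c ∈ K → Anchor K c
  Core⇒Anchor core c∈K = record
    { root∈ = c∈K
    ; rootNbr = let (a , _ , a∈K , _ , _ , c~a , _) = core c∈K in a , a∈K , c~a
    ; twoNbrs = λ u∈K _ → core u∈K
    }

  module _ {x y K} (x~y : x ~ y) (anchor : Anchor K y) where
    open Anchor anchor

    Anchor-extend-fresh : x ∉ K → Anchor (x ∷ K) x
    Anchor-extend-fresh x∉K = record
      { root∈ = here refl
      ; rootNbr = y , there root∈ , x~y
      ; twoNbrs = twoNbrs′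
      }
      where
      twoNbrs′ : ∀ {u} → u ∈ x ∷ K → u ≢ x → TwoNbrsIn (x ∷ K) u
      twoNbrs′ (here u≡x) u≢x = contradiction u≡x u≢x
      twoNbrs′ {u} (there u∈K) _ with u ≟ y | rootNbr
      ... | yes refl | z , z∈K , y~z =
        x , z , here refl , there z∈K , (λ { refl → x∉K z∈K }) , ~-sym x~y , y~z
      ... | no u≢y | _ = TwoNbrsIn-⊆ there (twoNbrs u∈K u≢y)

    Anchor-extend-shared : x ∈ K → ∀ {z} → z ∈ K → y ~ z → z ≢ x → Anchor K x
    Anchor-extend-shared x∈K z∈K y~z z≢x = record
      { root∈ = x∈K
      ; rootNbr = y , root∈ , x~y
      ; twoNbrs = twoNbrs′
      }
      where
      twoNbrs′ : ∀ {u} → u ∈ K → u ≢ x → TwoNbrsIn K u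
      twoNbrs′ {u} u∈K _ with u ≟ y
      ... | yes refl = x , _ , x∈K , z∈K , (≢-sym z≢x) , ~-sym x~y , y~z
      ... | no u≢y = twoNbrs u∈K u≢y

    Anchor-extend-pruned : x ∈ K → (∀ {z} → z ∈ K → y ~ z → z ≡ x) → Anchor (K ∖ y) x
    Anchor-extend-pruned x∈K only-x = record
      { root∈ = ∈-∖⁺ x∈K x≢y
      ; rootNbr = rootNbr′ (twoNbrs x∈K x≢y)
      ; twoNbrs = twoNbrs′
      }
      where
      x≢y : x ≢ y
      x≢y refl = ~-irrefl x~y
      rootNbr′ : TwoNbrsIn K x → Σ[ w ∈ V ] w ∈ K ∖ y × x ~ w
      rootNbr′ (a , b , a∈K , b∈K , a≢b , x~a , x~b) with a ≟ y
      ... | yes refl = b , ∈-∖⁺ b∈K (≢-sym a≢b) , x~b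
      ... | no a≢y = a , ∈-∖⁺ a∈K a≢y , x~a
      twoNbrs′ : ∀ {u} → u ∈ K ∖ y → u ≢ x → TwoNbrsIn (K ∖ y) u
      twoNbrs′ u∈K′ u≢x with u∈K , u≢y ← ∈-∖⁻ u∈K′
        with a , b , a∈K , b∈K , a≢b , u~a , u~b ← twoNbrs u∈K u≢y =
        a , b , ∈-∖⁺ a∈K (not-y u~a) , ∈-∖⁺ b∈K (not-y u~b) , a≢b , u~a , u~b
        where
        not-y : ∀ {w} → _ ~ w → w ≢ y
        not-y u~w refl = u≢x (only-x u∈K (~-sym u~w))

  Anchor-extend : ∀ {x y K} → x ~ y → Anchor K y → Σ[ K′ ∈ List V ] Anchor K′ x
  Anchor-extend {x} {y} {K} x~y anchor with x ∈? K
  ... | no x∉K = x ∷ K , Anchor-extend-fresh x~y anchor x∉K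
  ... | yes x∈K with any? (λ z → (y ~? z) ×-dec ¬? (z ≟ x)) K
  ...   | yes other = let (z , z∈K , y~z , z≢x) = find other in K , Anchor-extend-shared x~y anchor x∈K z∈K y~z z≢x
  ...   | no ¬other = _ , Anchor-extend-pruned x~y anchor x∈K only-x
    where
    only-x : ∀ {z} → z ∈ K → y ~ z → z ≡ x
    only-x {z} z∈K y~z with z ≟ x
    ... | yes z≡x = z≡x
    ... | no z≢x = contradiction (Any.map (λ { refl → y~z , z≢x }) z∈K) ¬other

  reach : ∀ {K c x} → Core K → c ∈ K → Star _~_ x c → Σ[ K′ ∈ List V ] Anchor K′ x
  reach core c∈K ε = _ , Core⇒Anchor core c∈K
  reach core c∈K (x~y ◅ walk) = Anchor-extend x~y (proj₂ (reach core c∈K walk))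

  IsCycle : List V → Set
  IsCycle ws = Unique ws × Closed _~_ ws × 3 ≤ length ws

  cycle-head-twoNbrs : ∀ {u rs} → IsCycle (u ∷ rs) → TwoNbrsIn (u ∷ rs) u
  cycle-head-twoNbrs {u} {rs} cyc with initLast rs
  cycle-head-twoNbrs (_ , _ , s≤s ()) | []
  cycle-head-twoNbrs (_ , _ , s≤s (s≤s ())) | [] ∷ʳ′ z
  cycle-head-twoNbrs {u} ((_ ∷ (r∉ ∷ _)) , (u~r , c) , _) | (r ∷ ms) ∷ʳ′ z =
    r , z , there (here refl) , there (there z∈) , All.lookup r∉ z∈ , u~r , ~-sym z~u
    where
    z∈ : z ∈ ms ∷ʳ z
    z∈ = ∈-++⁺ʳ ms (here refl)
    z~u : z ~ u
    z~u = subst (_~ u) (end-∷ʳ _~_ r ms z) (proj₂ (Chain-∷ʳ⁻ _~_ r (ms ∷ʳ z) c))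

  Cycle⇒Core : ∀ {ws} → IsCycle ws → Core ws
  Cycle⇒Core {ws} (ws! , closed , 3≤|ws|) u∈ws with as , bs , refl ← ∈-∃++ u∈ws =
    TwoNbrsIn-⊆ (∈-resp-↭ (++-comm (_ ∷ bs) as)) (cycle-head-twoNbrs
      ( Unique-resp-↭ (++-comm as (_ ∷ bs)) ws!
      , Closed-rotate _~_ as (_ ∷ bs) closed
      , subst (3 ≤_) (xs↭ys⇒|xs|≡|ys| (++-comm as (_ ∷ bs))) 3≤|ws|))

  closed-odd⇒3≤length : ∀ {ws} → Closed _~_ ws → Odd (length ws) → 3 ≤ length ws
  closed-odd⇒3≤length {[]} _ ()
  closed-odd⇒3≤length {_ ∷ []} (x~x , _) _ = contradiction x~x ~-irrefl
  closed-odd⇒3≤length {_ ∷ _ ∷ []} _ ()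
  closed-odd⇒3≤length {_ ∷ _ ∷ _ ∷ _} _ _ = s≤s (s≤s (s≤s z≤n))

  cut-loop : ∀ as y bs ds → Closed _~_ (as ++ y ∷ bs ++ y ∷ ds) → Closed _~_ (y ∷ bs) × Closed _~_ (as ++ y ∷ ds)
  cut-loop as y bs ds closed =
    let (loop , rest) = Closed-split _~_ y bs (ds ++ as)
                          (subst (Closed _~_) (cong (y ∷_) (++-assoc bs (y ∷ ds) as))
                            (Closed-rotate _~_ as (y ∷ bs ++ y ∷ ds) closed))
    in loop , Closed-rotate _~_ (y ∷ ds) as rest

  -- A repeated vertex splits an odd closed walk into two shorter closed walks, one of them odd.
  odd-closed-walk⇒cycle : ∀ n ws → length ws < n → Closed _~_ ws → Odd (length ws) →
                          Σ[ K ∈ List V ] IsCycle K × K ⊆ ws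
  odd-closed-walk⇒cycle (suc n) ws |ws|<1+n closed odd with unique-or-repeat ws
  ... | inj₁ ws! = ws , (ws! , closed , closed-odd⇒3≤length {ws} closed odd) , λ x∈ → x∈
  ... | inj₂ (as , y , bs , ds , refl) =
    [ via-loop , via-rest ]′ (odd-+ (length (y ∷ bs)) (length (as ++ y ∷ ds)) (subst Odd |ws|≡ odd))
    where
    loop×rest = cut-loop as y bs ds closed
    ⊆ws : (y ∷ bs) ++ as ++ y ∷ ds ⊆ as ++ y ∷ bs ++ y ∷ ds
    ⊆ws = ∈-resp-↭ (↭-sym (cut-loop-↭ as y bs ds))
    |ws|≡ : length (as ++ y ∷ bs ++ y ∷ ds) ≡ length (y ∷ bs) + length (as ++ y ∷ ds)
    |ws|≡ = trans (xs↭ys⇒|xs|≡|ys| (cut-loop-↭ as y bs ds)) (length-++ (y ∷ bs))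
    |ws|≤n : length (y ∷ bs) + length (as ++ y ∷ ds) ≤ n
    |ws|≤n = subst (_≤ n) |ws|≡ (≤-pred |ws|<1+n)
    via-loop : Odd (length (y ∷ bs)) → Σ[ K ∈ List V ] IsCycle K × K ⊆ as ++ y ∷ bs ++ y ∷ ds
    via-loop odd-loop =
      let (K , cyc , K⊆) = odd-closed-walk⇒cycle n (y ∷ bs) (<-≤-trans (m<m+n _ |rest|>0) |ws|≤n)
                             (proj₁ loop×rest) odd-loop
      in K , cyc , ⊆ws ∘ ∈-++⁺ˡ ∘ K⊆
      where
      |rest|>0 : 0 < length (as ++ y ∷ ds)
      |rest|>0 = subst (0 <_) (sym (length-++ as)) (<-≤-trans (s≤s z≤n) (m≤n+m _ (length as)))
    via-rest : Odd (length (as ++ y ∷ ds)) → Σ[ K ∈ List V ] IsCycle K × K ⊆ as ++ y ∷ bs ++ y ∷ ds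
    via-rest odd-rest =
      let (K , cyc , K⊆) = odd-closed-walk⇒cycle n (as ++ y ∷ ds) (<-≤-trans (m<n+m _ (s≤s z≤n)) |ws|≤n)
                             (proj₂ loop×rest) odd-rest
      in K , cyc , ⊆ws ∘ ∈-++⁺ʳ (y ∷ bs) ∘ K⊆

  Path : V → List V → V → Set
  Path u mid v = Chain _~_ u (mid ∷ʳ v) × Unique (u ∷ mid ∷ʳ v)

  module _ (u v : V) where

    infix 4 _~⁺_
    _~⁺_ : V → V → Set
    _~⁺_ = AdjPlus (adj G) u v

    ~⁺-sym : ∀ {a b} → a ~⁺ b → b ~⁺ a
    ~⁺-sym (inj₁ a~b) = inj₁ (~-sym a~b)
    ~⁺-sym (inj₂ (inj₁ (a≡u , b≡v))) = inj₂ (inj₂ (b≡v , a≡u))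
    ~⁺-sym (inj₂ (inj₂ (a≡v , b≡u))) = inj₂ (inj₁ (b≡u , a≡v))

    chain-avoiding-v : ∀ {x xs} → All (v ≢_) (x ∷ xs) → Chain _~⁺_ x xs → Chain _~_ x xs
    chain-avoiding-v {xs = []} _ _ = tt
    chain-avoiding-v {xs = y ∷ _} (v≢x ∷ v≢y ∷ v≢ys) (x~⁺y , c) = edge x~⁺y , chain-avoiding-v (v≢y ∷ v≢ys) c
      where
      edge : _ ~⁺ y → _ ~ y
      edge (inj₁ x~y) = x~y
      edge (inj₂ (inj₁ (_ , refl))) = contradiction refl v≢y
      edge (inj₂ (inj₂ (refl , _))) = contradiction refl v≢x

    closed-avoiding-v : ∀ {ws} → All (v ≢_) ws → Closed _~⁺_ ws → Closed _~_ ws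
    closed-avoiding-v {[]} _ _ = tt
    closed-avoiding-v {w ∷ ws} (v≢w ∷ v≢ws) = chain-avoiding-v (v≢w ∷ ∷ʳ⁺ v≢ws v≢w)

    split-closed-at-v : ∀ {r ms z} → Closed _~⁺_ (v ∷ r ∷ ms ∷ʳ z) → Unique (v ∷ r ∷ ms ∷ʳ z) →
                        v ~⁺ r × Chain _~_ r (ms ∷ʳ z) × z ~⁺ v
    split-closed-at-v {r} {ms} {z} (v~⁺r , c) ((v≢r ∷ v≢rest) ∷ _) =
      let (inner , z~⁺v) = Chain-∷ʳ⁻ _~⁺_ r (ms ∷ʳ z) c
      in v~⁺r , chain-avoiding-v (v≢r ∷ v≢rest) inner , subst (_~⁺ v) (end-∷ʳ _~⁺_ r ms z) z~⁺v

    -- The closed walk starts at v and its first edge is the added edge vu.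
    path-after-new-edge : ∀ {r ms z} → Closed _~⁺_ (v ∷ r ∷ ms ∷ʳ z) → Unique (v ∷ r ∷ ms ∷ʳ z) → ¬ v ~ r →
                          Path u (ms ∷ʳ z) v
    path-after-new-edge {r} {ms} {z} closed v!@((v≢r ∷ v≢rest) ∷ ((r≢rest ∷ _))) ¬v~r
      with v~⁺r , inner , z~⁺v ← split-closed-at-v closed v! =
      subst (λ w → Path w (ms ∷ʳ z) v) r≡u
        ( Chain-∷ʳ⁺ _~_ (ms ∷ʳ z) inner (subst (_~ v) (sym (end-∷ʳ _~_ r ms z)) (old z~⁺v))
        , Unique-resp-↭ (∷↭∷ʳ v (r ∷ ms ∷ʳ z)) v!)
      where
      z∈ : z ∈ ms ∷ʳ z
      z∈ = ∈-++⁺ʳ ms (here refl)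
      new : v ~⁺ r → r ≡ u
      new (inj₁ v~r) = contradiction v~r ¬v~r
      new (inj₂ (inj₁ (_ , r≡v))) = contradiction (sym r≡v) v≢r
      new (inj₂ (inj₂ (_ , r≡u))) = r≡u
      r≡u : r ≡ u
      r≡u = new v~⁺r
      old : z ~⁺ v → z ~ v
      old (inj₁ z~v) = z~v
      old (inj₂ (inj₁ (z≡u , _))) = contradiction (trans r≡u (sym z≡u)) (All.lookup r≢rest z∈)
      old (inj₂ (inj₂ (z≡v , _))) = contradiction (sym z≡v) (All.lookup v≢rest z∈)

    path-from-closed-walk-at-v : ∀ {rs} → Closed _~⁺_ (v ∷ rs) → Unique (v ∷ rs) → ¬ Closed _~_ (v ∷ rs) →
                                 2 ≤ length rs → Σ[ mid ∈ List V ] Path u mid v × suc (length mid) ≡ length rs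
    path-from-closed-walk-at-v {rs} _ _ _ 2≤|rs| with initLast rs
    path-from-closed-walk-at-v _ _ _ () | []
    path-from-closed-walk-at-v _ _ _ (s≤s ()) | [] ∷ʳ′ _
    path-from-closed-walk-at-v closed v! ¬closed _ | (r ∷ ms) ∷ʳ′ z with v ~? r | z ~? v
    ... | no ¬v~r | _ = ms ∷ʳ z , path-after-new-edge closed v! ¬v~r , refl
    ... | yes v~r | no ¬z~v =
      reverse ms ∷ʳ r , path-after-new-edge closed′ v!′ (¬z~v ∘ ~-sym) ,
      trans (cong length (sym rev-shape)) (length-reverse (r ∷ ms ∷ʳ z))
      where
      rev-shape : reverse (r ∷ ms ∷ʳ z) ≡ z ∷ reverse ms ∷ʳ r
      rev-shape = trans (unfold-reverse r (ms ∷ʳ z)) (cong (_∷ʳ r) (reverse-++ ms [ z ]))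
      closed′ : Closed _~⁺_ (v ∷ z ∷ reverse ms ∷ʳ r)
      closed′ = subst (λ ws → Chain _~⁺_ v (ws ∷ʳ v)) rev-shape (Chain-reverse _~⁺_ ~⁺-sym (r ∷ ms ∷ʳ z) closed)
      v!′ : Unique (v ∷ z ∷ reverse ms ∷ʳ r)
      v!′ = subst (Unique ∘ (v ∷_)) rev-shape (Unique-resp-↭ (↭-prep v (↭-sym (↭-reverse (r ∷ ms ∷ʳ z)))) v!)
    ... | yes v~r | yes z~v with _ , inner , _ ← split-closed-at-v closed v! =
      contradiction (v~r , Chain-∷ʳ⁺ _~_ (ms ∷ʳ z) inner (subst (_~ v) (sym (end-∷ʳ _~_ r ms z)) z~v)) ¬closed

    -- The new cycle must pass through v; rotated to start at v, its first or last edge is vu.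
    saturating-cycle⇒path : ∀ m → ¬ ContainsCycle (3 + m) _~_ → ContainsCycle (3 + m) _~⁺_ →
                            Σ[ mid ∈ List V ] Path u mid v × length mid ≡ suc m
    saturating-cycle⇒path m no-cycle (f , f-inj , f-adj) = through-v (v ∈? tabulate f)
      where
      closed : Closed _~⁺_ (tabulate f)
      closed = closed-tabulate⁺ f f-adj
      ¬closed : ¬ Closed _~_ (tabulate f)
      ¬closed c = no-cycle (f , (λ {i j} → f-inj {i} {j}) , closed-tabulate⁻ f c)
      through-v : Dec (v ∈ tabulate f) → Σ[ mid ∈ List V ] Path u mid v × length mid ≡ suc m
      through-v (no v∉ws) = contradiction (closed-avoiding-v (¬Any⇒All¬ _ v∉ws) closed) ¬closed
      through-v (yes v∈ws) with as , bs , ws≡ ← ∈-∃++ v∈ws =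
        let (mid , path , |mid|≡) = path-from-closed-walk-at-v closed′ unique′ ¬closed′ 2≤|bs++as|
        in mid , path , suc-injective (trans |mid|≡ |bs++as|≡)
        where
        closed′ : Closed _~⁺_ (v ∷ bs ++ as)
        closed′ = Closed-rotate _~⁺_ as (v ∷ bs) (subst (Closed _~⁺_) ws≡ closed)
        unique′ : Unique (v ∷ bs ++ as)
        unique′ = Unique-resp-↭ (++-comm as (v ∷ bs)) (subst Unique ws≡ (tabulate⁺ f-inj))
        ¬closed′ : ¬ Closed _~_ (v ∷ bs ++ as)
        ¬closed′ = ¬closed ∘ subst (Closed _~_) (sym ws≡) ∘ Closed-rotate _~_ (v ∷ bs) as
        |bs++as|≡ : length (bs ++ as) ≡ suc (suc m)
        |bs++as|≡ = suc-injective (begin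
          length (v ∷ bs ++ as)   ≡⟨ xs↭ys⇒|xs|≡|ys| (++-comm (v ∷ bs) as) ⟩
          length (as ++ v ∷ bs)   ≡⟨ cong length ws≡ ⟨
          length (tabulate f)     ≡⟨ length-tabulate f ⟩
          3 + m                   ∎)
          where open ≡-Reasoning
        2≤|bs++as| : 2 ≤ length (bs ++ as)
        2≤|bs++as| = subst (2 ≤_) (sym |bs++as|≡) (s≤s (s≤s z≤n))

  module Anchored
    (vertices : List V) (∈-vertices : ∀ v → v ∈ vertices)
    (Host : V → V → Set) (host-sym : ∀ {a b} → Host a b → Host b a) (host-irrefl : ∀ {a} → ¬ Host a a)
    (common-host-nbr : ∀ a b → Σ[ y ∈ V ] Host a y × Host b y)
    (m : ℕ) (detour : ∀ {a b} → Host a b → ¬ a ~ b → Σ[ mid ∈ List V ] Path a mid b × length mid ≡ suc (suc m))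
    where

    has-nbr : ∀ x → Σ[ y ∈ V ] x ~ y
    has-nbr x with y , x-y , _ ← common-host-nbr x x with x ~? y
    ... | yes x~y = y , x~y
    ... | no ¬x~y with detour x-y ¬x~y
    ...   | w ∷ _ , ((x~w , _) , _) , _ = w , x~w

    CycleReachableFrom : V → Set
    CycleReachableFrom x = Σ[ K ∈ List V ] IsCycle K × Σ[ c ∈ V ] c ∈ K × Star _~_ x c

    Leaf : V → V → Set
    Leaf a b = a ~ b × (∀ {z} → a ~ z → z ≡ b)

    -- For a common host-neighbour y of a and b, the detour a b … y closes into a cycle with the
    -- edge yb, or with a detour y … b into a closed walk of odd length.
    leaf⇒cycle : ∀ {a b} → Leaf a b → CycleReachableFrom a
    leaf⇒cycle {a} {b} (a~b , only-b)
      with y , a-y , b-y ← common-host-nbr a b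
      with detour a-y (λ a~y → host-irrefl (subst (Host b) (only-b a~y) b-y))
    ... | b′ ∷ m₂ ∷ ms , ((a~b′ , chain) , (_ ∷ b∷ms!)) , |mid|≡ with refl ← only-b a~b′ with b ~? y
    ... | yes b~y = b ∷ m₂ ∷ ms ∷ʳ y , (b∷ms! , closed , 3≤length b m₂ ms y) , b , here refl , a~b ◅ ε
      where
      closed : Closed _~_ (b ∷ m₂ ∷ ms ∷ʳ y)
      closed = Chain-∷ʳ⁺ _~_ (m₂ ∷ ms ∷ʳ y) chain (subst (_~ b) (sym (end-∷ʳ _~_ m₂ ms y)) (~-sym b~y))
    ... | no ¬b~y with mid′ , (chain′ , _) , |mid′|≡ ← detour (host-sym b-y) (¬b~y ∘ ~-sym) =
      let (K , cyc , K⊆W) = odd-closed-walk⇒cycle (suc (length W)) W ≤-refl closed odd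
          (c , c∈K) = head-of-cycle cyc
      in K , cyc , c , c∈K , a~b ◅ Closed⇒Star closed (K⊆W c∈K)
      where
      W = b ∷ (m₂ ∷ ms) ++ y ∷ mid′
      closed : Closed _~_ W
      closed = subst (Chain _~_ b) (sym (++-assoc (m₂ ∷ ms) (y ∷ mid′) [ b ]))
        (Chain-++⁺ _~_ (m₂ ∷ ms) (proj₁ (Chain-∷ʳ⁻ _~_ b (m₂ ∷ ms) chain)) (proj₂ (Chain-∷ʳ⁻ _~_ b (m₂ ∷ ms) chain) , chain′))
      odd : Odd (length W)
      odd = subst Odd (sym |W|≡) (odd-1+2* (suc (suc m)))
        where
        |W|≡ : length W ≡ suc (suc (suc m) * 2)
        |W|≡ = begin
          suc (length ((m₂ ∷ ms) ++ y ∷ mid′))           ≡⟨ cong suc (length-++ (m₂ ∷ ms)) ⟩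
          suc (length (m₂ ∷ ms) + suc (length mid′))     ≡⟨ cong₂ (λ p q → suc (p + suc q)) (suc-injective |mid|≡) |mid′|≡ ⟩
          suc (suc m + suc (suc (suc m)))                ≡⟨ cong suc (arith m) ⟩
          suc (suc (suc m) * 2)                          ∎
          where
          open ≡-Reasoning
          arith : ∀ m → suc m + suc (suc (suc m)) ≡ suc (suc m) * 2
          arith = solve-∀
      head-of-cycle : ∀ {K} → IsCycle K → Σ[ c ∈ V ] c ∈ K
      head-of-cycle {c ∷ _} _ = c , here refl

    -- The walk cur ∷ p ∷ ps is stored backwards: cur is the current vertex, p the previous one.
    non-backtracking-walk : ∀ fuel {x} cur p ps → length vertices < fuel + length (cur ∷ p ∷ ps) →
                            Chain _~_ cur (p ∷ ps) → Unique (cur ∷ p ∷ ps) → Star _~_ x cur →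
                            CycleReachableFrom x ⊎ Σ[ a ∈ V ] Σ[ b ∈ V ] Star _~_ x a × Leaf a b
    non-backtracking-walk zero cur p ps |V|<|walk| _ walk! _ =
      contradiction (Unique⊆⇒length≤ walk! (λ {w} _ → ∈-vertices w)) (<⇒≱ |V|<|walk|)
    non-backtracking-walk (suc fuel) cur p ps |V|< chain walk! x⇝cur
      with any? (λ w → (cur ~? w) ×-dec ¬? (w ≟ p)) vertices
    ... | no ¬step = inj₂ (cur , p , x⇝cur , (proj₁ chain , only-p))
      where
      only-p : ∀ {z} → cur ~ z → z ≡ p
      only-p {z} cur~z with z ≟ p
      ... | yes z≡p = z≡p
      ... | no z≢p = contradiction (Any.map (λ { refl → cur~z , z≢p }) (∈-vertices z)) ¬step
    ... | yes step with w , _ , cur~w , w≢p ← find step with w ∈? (cur ∷ p ∷ ps)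
    ...   | yes (here refl) = contradiction cur~w ~-irrefl
    ...   | yes (there (here w≡p)) = contradiction w≡p w≢p
    ...   | yes (there (there w∈ps)) with as , bs , refl ← ∈-∃++ w∈ps =
      inj₁ (cur ∷ p ∷ as ∷ʳ w , (cycle! , closed , 3≤length cur p as w) , cur , here refl , x⇝cur)
      where
      cycle! : Unique (cur ∷ p ∷ as ∷ʳ w)
      cycle! = Unique-++⁻ˡ (cur ∷ p ∷ as ∷ʳ w)
                 (subst Unique (sym (cong (λ t → cur ∷ p ∷ t) (++-assoc as [ w ] bs))) walk!)
      closed : Closed _~_ (cur ∷ p ∷ as ∷ʳ w)
      closed = Chain-∷ʳ⁺ _~_ (p ∷ as ∷ʳ w)
        (proj₁ (Chain-++⁻ _~_ cur (p ∷ as ∷ʳ w)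
          (subst (Chain _~_ cur) (cong (p ∷_) (sym (++-assoc as [ w ] bs))) chain)))
        (subst (_~ cur) (sym (end-∷ʳ _~_ p as w)) (~-sym cur~w))
    ...   | no w∉walk = non-backtracking-walk fuel w cur (p ∷ ps)
                          (subst (length vertices <_) (sym (+-suc fuel _)) |V|<)
                          (~-sym cur~w , chain) (¬Any⇒All¬ _ w∉walk ∷ walk!) (x⇝cur ◅◅ cur~w ◅ ε)

    anchored : ∀ x → Σ[ K ∈ List V ] Anchor K x
    anchored x with y , x~y ← has-nbr x
      with non-backtracking-walk (length vertices) y x [] (m<m+n _ (s≤s z≤n)) (~-sym x~y , tt)
             (((λ { refl → ~-irrefl x~y }) ∷ []) ∷ [] ∷ []) (x~y ◅ ε)
    ... | inj₁ (K , cycle , c , c∈K , x⇝c) = reach (Cycle⇒Core cycle) c∈K x⇝c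
    ... | inj₂ (a , b , x⇝a , leaf) =
      let (K , cycle , c , c∈K , a⇝c) = leaf⇒cycle leaf
      in reach (Cycle⇒Core cycle) c∈K (x⇝a ◅◅ a⇝c)

∈-allVtx : ∀ {k n} (v : Vtx k n) → v ∈ allVtx k n
∈-allVtx (i , j) = ∈-cartesianProduct⁺ (∈-allFin i) (∈-allFin j)

allVtx! : ∀ k n → Unique (allVtx k n)
allVtx! k n = cartesianProduct⁺ (allFin⁺ k) (allFin⁺ n)

length-allVtx : ∀ k n → length (allVtx k n) ≡ k * n
length-allVtx k n =
  trans (length-cartesianProduct (allFin k) (allFin n)) (cong₂ _*_ (length-tabulate {n = k} id) (length-tabulate {n = n} id))

<ᵇ≡true⇒< : ∀ {a b} → (a <ᵇ b) ≡ true → a < b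
<ᵇ≡true⇒< {a} {b} eq = <ᵇ⇒< a b (subst T (sym eq) tt)

<ᵇ≡false⇒≮ : ∀ {a b} → (a <ᵇ b) ≡ false → ¬ a < b
<ᵇ≡false⇒≮ eq a<b = subst T eq (<⇒<ᵇ a<b)

index-injective : ∀ {k n} {u v : Vtx k n} → index u ≡ index v → u ≡ v
index-injective {k} {n} {i , j} {i′ , j′} e = begin
  (i , j)                            ≡⟨ Finₚ.remQuot-combine i j ⟨
  Fin.remQuot n (Fin.combine i j)    ≡⟨ cong (Fin.remQuot n) (Finₚ.toℕ-injective combine≡) ⟩
  Fin.remQuot n (Fin.combine i′ j′)  ≡⟨ Finₚ.remQuot-combine i′ j′ ⟩
  (i′ , j′)                          ∎
  where
  open ≡-Reasoning
  index≡toℕ-combine : ∀ (a : Fin k) (b : Fin n) → index (a , b) ≡ toℕ (Fin.combine a b)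
  index≡toℕ-combine a b = trans (cong (_+ toℕ b) (*-comm (toℕ a) n)) (sym (Finₚ.toℕ-combine a b))
  combine≡ : toℕ (Fin.combine i j) ≡ toℕ (Fin.combine i′ j′)
  combine≡ = trans (sym (index≡toℕ-combine i j)) (trans e (index≡toℕ-combine i′ j′))

avoid-two : ∀ {k} (p q : Fin (3 + k)) → Σ[ c ∈ Fin (3 + k) ] p ≢ c × q ≢ c
avoid-two zero zero = suc zero , (λ ()) , (λ ())
avoid-two zero (suc zero) = suc (suc zero) , (λ ()) , (λ ())
avoid-two zero (suc (suc _)) = suc zero , (λ ()) , (λ ())
avoid-two (suc zero) zero = suc (suc zero) , (λ ()) , (λ ())
avoid-two (suc (suc _)) zero = suc zero , (λ ()) , (λ ())
avoid-two (suc _) (suc _) = zero , (λ ()) , (λ ())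

module _ {k n : ℕ} (H : Graph (Vtx k n)) where

  open WithGraph (≡-dec Finₚ._≟_ Finₚ._≟_) H

  edge< : Vtx k n → Vtx k n → ℕ
  edge< u v = ⟦ adj H u v ∧ (index u <ᵇ index v) ⟧

  edgeCount≡∑ : edgeCount H ≡ ∑[ u ∈ allVtx k n ] ∑[ v ∈ allVtx k n ] edge< u v
  edgeCount≡∑ = trans (length-filter-T? _ (cartesianProduct (allVtx k n) (allVtx k n)))
                      (∑-cartesianProduct (allVtx k n) (allVtx k n) _)

  -- Every edge {u,v} is counted once as an ordered pair with index u < index v.
  ⟦adj⟧≡edge<+edge< : ∀ v u → ⟦ adj H v u ⟧ ≡ edge< v u + edge< u v
  ⟦adj⟧≡edge<+edge< v u rewrite Graph.sym H u v with adj H v u in v~u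
  ... | false = refl
  ... | true with index v <ᵇ index u in v<u | index u <ᵇ index v in u<v
  ...   | true | false = refl
  ...   | false | true = refl
  ...   | true | true = contradiction (<ᵇ≡true⇒< {index u} u<v) (<-asym (<ᵇ≡true⇒< {index v} v<u))
  ...   | false | false = contradiction (trans (sym v~u) (trans (cong (adj H v) (sym v≡u)) (irrefl H v))) λ ()
    where
    v≡u : v ≡ u
    v≡u = index-injective (≤-antisym (≮⇒≥ (<ᵇ≡false⇒≮ u<v)) (≮⇒≥ (<ᵇ≡false⇒≮ v<u)))

  degSum≡edgeCount*2 : degSum (allVtx k n) ≡ edgeCount H * 2
  degSum≡edgeCount*2 = begin
    ∑[ v ∈ vs ] ∑[ u ∈ vs ] ⟦ adj H v u ⟧                      ≡⟨ ∑-cong vs (λ v → ∑-cong vs (⟦adj⟧≡edge<+edge< v)) ⟩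
    ∑[ v ∈ vs ] ∑[ u ∈ vs ] (edge< v u + edge< u v)            ≡⟨ ∑-cong vs (λ v → ∑-+ vs (edge< v) (λ u → edge< u v)) ⟩
    ∑[ v ∈ vs ] (∑[ u ∈ vs ] edge< v u + ∑[ u ∈ vs ] edge< u v) ≡⟨ ∑-+ vs _ _ ⟩
    e + ∑[ v ∈ vs ] ∑[ u ∈ vs ] edge< u v                      ≡⟨ cong (e +_) (∑-comm vs vs (λ v u → edge< u v)) ⟩
    e + e                                                      ≡⟨ cong (λ d → d + d) edgeCount≡∑ ⟨
    edgeCount H + edgeCount H                                  ≡⟨ cong (edgeCount H +_) (+-identityʳ (edgeCount H)) ⟨
    2 * edgeCount H                                            ≡⟨ *-comm 2 (edgeCount H) ⟩
    edgeCount H * 2                                            ∎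
    where
    open ≡-Reasoning
    vs = allVtx k n
    e = ∑[ u ∈ vs ] ∑[ v ∈ vs ] edge< u v

saturated⇒kn≤edgeCount : ∀ {k′ n r} (H : Graph (Vtx (3 + k′) n)) → SaturatedRel (3 + k′) n (4 + r) H →
                         (3 + k′) * n ≤ edgeCount H
saturated⇒kn≤edgeCount {k′} {n} {r} H (_ , no-C , saturating) = *-cancelʳ-≤ (k * n) (edgeCount H) 2 (begin
  k * n * 2                ≡⟨ cong (_* 2) (length-allVtx k n) ⟨
  length (allVtx k n) * 2  ≤⟨ length*2≤degSum _ (allVtx k n) refl (allVtx! k n) (λ {x} _ → anchored-in-all x) ⟩
  degSum (allVtx k n)      ≡⟨ degSum≡edgeCount*2 H ⟩
  edgeCount H * 2          ∎)
  where
  open ≤-Reasoning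
  k = 3 + k′
  open WithGraph (≡-dec Finₚ._≟_ Finₚ._≟_) H
  common-host-nbr : ∀ (a b : Vtx k n) → Σ[ y ∈ Vtx k n ] hostAdj a y × hostAdj b y
  common-host-nbr a b = let (c , a≢c , b≢c) = avoid-two (proj₁ a) (proj₁ b) in (c , proj₂ a) , a≢c , b≢c
  open Anchored (allVtx k n) ∈-allVtx hostAdj (λ a≢b b≡a → a≢b (sym b≡a)) (λ a≢a → a≢a refl) common-host-nbr
                r (λ {a} {b} a-b ¬a~b → saturating-cycle⇒path a b (suc r) no-C (saturating a b a-b ¬a~b))
  anchored-in-all : ∀ x → AnchoredIn (allVtx k n) x
  anchored-in-all x = let (K , anchor) = anchored x in K , (λ {w} _ → ∈-allVtx w) , anchor

theorem1p2 : ∀ (ℓ k n : ℕ) → 4 ≤ ℓ → 3 ≤ k → ℓ ≤ k * n →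
    ∀ (H : Graph (Vtx k n)) → SaturatedRel k n ℓ H → k * n ≤ edgeCount H
theorem1p2 _ _ _ (s≤s (s≤s (s≤s (s≤s _)))) (s≤s (s≤s (s≤s _))) _ = saturated⇒kn≤edgeCount
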